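{- Let $H\colon\mathbb K_p\to\mathbf{Set}$ be a ($\mathbf{Set}$-valued) connected directed hereditary species, and let $\mathbb H$ be the category described in the context. Then $\mathbb H$ is a category with chosen local terminal objects, the chosen local terminal objects being the objects $(1,x)$ with $1$ the one-element poset and $x\in H[1]$.
   Context: A map of posets $f\colon P\to Q$ is convex if for all $x,y\in P$ and $w\in Q$ with $f(x)\le w\le f(y)$ there is a unique $p$ with $x\le p\le y$, $f(p)=w$. A contraction is a monotone surjection whose fibres $f^{ -1}(q)$ are connected convex subposets and such that every cover $q\lessdot q'$ in $Q$ ($q<q'$, nothing strictly between) lifts to a cover $p\lessdot p'$ in $P$. $\mathbb K$ is the category of finite connected non-empty posets and contractions; $\mathbb K_p$ has the same objects, with morphisms spans $P\leftarrow P'\to Q$ (convex map, contraction) composed by pullback. A connected directed hereditary species is a functor $H\colon\mathbb K_p\to\mathbf{Set}$. $\mathbb H$ is the pullback along $\mathbb K\hookrightarrow\mathbb K_p$ of the Grothendieck construction $\int H\to\mathbb K_p$: its objects are pairs $(P,x)$ with $x\in H[P]$ and its morphisms $(P,x)\to(Q,y)$ are contractions $f\colon P\to Q$ with $H(P=P\xrightarrow fQ)(x)=y$. A category has chosen local terminal objects if in each connected component a terminal object of that component is chosen. -}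

module Defs where

open import Data.Nat using (ℕ)
open import Data.Fin using (Fin; zero)
import Data.Fin as Fin
open import Data.Unit using (⊤; tt)
open import Data.Product using (Σ; ∃; ∃-syntax; _×_; _,_; proj₁; proj₂)
open import Data.Sum using (_⊎_; inj₁; inj₂)
open import Relation.Nullary using (¬_)
open import Relation.Binary.PropositionalEquality
  using (_≡_; _≢_; refl; sym; trans; isEquivalence)
open import Relation.Binary.Structures using (IsPartialOrder; IsPreorder)
open import Relation.Binary.Construct.Closure.ReflexiveTransitive
  using (Star; ε; _◅_)
open import Function.Bundles using (_↔_; mk↔ₛ′)
open import Level using (Level; _⊔_) renaming (suc to lsuc)

record FinPoset : Set₁ where
  field
    Carrier        : Set
    _≤_            : Carrier → Carrier → Set
    isPartialOrder : IsPartialOrder _≡_ _≤_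
    size           : ℕ
    enum           : Fin size ↔ Carrier
    point          : Carrier
    connected      : ∀ x y →
                     Star (λ a b → (a ≤ b) ⊎ (b ≤ a)) x y

open FinPoset public

Cover : (P : FinPoset) → Carrier P → Carrier P → Set
Cover P a b = (_≤_ P a b × a ≢ b) ×
              (∀ c → ¬ ((_≤_ P a c × a ≢ c) × (_≤_ P c b × c ≢ b)))

record IsConvex (P Q : FinPoset) (f : Carrier P → Carrier Q) : Set where
  field
    mono   : ∀ {x y} → _≤_ P x y → _≤_ Q (f x) (f y)
    convex : ∀ x y w → _≤_ Q (f x) w → _≤_ Q w (f y) →
             Σ (Carrier P) λ p →
               (_≤_ P x p × _≤_ P p y × f p ≡ w) ×
               (∀ p′ → (_≤_ P x p′ × _≤_ P p′ y × f p′ ≡ w) → p′ ≡ p)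

record IsContraction (P Q : FinPoset) (f : Carrier P → Carrier Q) : Set where
  field
    mono            : ∀ {x y} → _≤_ P x y → _≤_ Q (f x) (f y)
    surjective      : ∀ q → Σ (Carrier P) λ p → f p ≡ q
    fibre-connected : ∀ q x y → f x ≡ q → f y ≡ q →
                      Star (λ a b → (f a ≡ q × f b ≡ q) ×
                                    ((_≤_ P a b) ⊎ (_≤_ P b a))) x y
    fibre-convex    : ∀ q x z y → _≤_ P x z → _≤_ P z y →
                      f x ≡ q → f y ≡ q → f z ≡ q
    covers-lift     : ∀ q q′ → Cover Q q q′ →
                      Σ (Carrier P) λ p → Σ (Carrier P) λ p′ →
                        Cover P p p′ × f p ≡ q × f p′ ≡ q′

record Contraction (P Q : FinPoset) : Set where
  field
    fun           : Carrier P → Carrier Q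
    isContraction : IsContraction P Q fun

open Contraction public

-- Morphisms of 𝕂_p : spans  P ← A → Q  (convex, contraction)

record Span (P Q : FinPoset) : Set₁ where
  field
    apex     : FinPoset
    left     : Carrier apex → Carrier P
    left-cvx : IsConvex apex P left
    right    : Carrier apex → Carrier Q
    right-ct : IsContraction apex Q right

open Span public

id-convex : (P : FinPoset) → IsConvex P P (λ x → x)
id-convex P = record
  { mono   = λ p → p
  ; convex = λ x y w x≤w w≤y →
      w , (x≤w , w≤y , refl) , λ p′ h → proj₂ (proj₂ h) }

id-contraction : (P : FinPoset) → IsContraction P P (λ x → x)
id-contraction P = record
  { mono            = λ p → p
  ; surjective      = λ q → q , refl
  ; fibre-connected = λ q x y x≡q y≡q → helper x≡q y≡q
  ; fibre-convex    = λ q x z y x≤z z≤y x≡q y≡q → cvx x≤z z≤y x≡q y≡q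
  ; covers-lift     = λ q q′ c → q , q′ , c , refl , refl }
  where
  cvx : ∀ {q x z y} → _≤_ P x z → _≤_ P z y → x ≡ q → y ≡ q → z ≡ q
  cvx x≤z z≤y refl refl =
    sym (IsPartialOrder.antisym (isPartialOrder P) x≤z z≤y)
  helper : ∀ {q x y} → x ≡ q → y ≡ q →
           Star (λ a b → (a ≡ q × b ≡ q) × ((_≤_ P a b) ⊎ (_≤_ P b a))) x y
  helper refl refl = ε

idSpan : (P : FinPoset) → Span P P
idSpan P = record
  { apex = P ; left = λ x → x ; left-cvx = id-convex P
  ; right = λ x → x ; right-ct = id-contraction P }

ι : ∀ {P Q} → Contraction P Q → Span P Q
ι {P} {Q} f = record
  { apex = P ; left = λ x → x ; left-cvx = id-convex P
  ; right = fun f ; right-ct = isContraction f }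

-- s is (a representative of) the composite of s₁ and s₂ in 𝕂_p:
-- its apex is a pullback (in posets) of  right s₁  and  left s₂,
-- and its legs are the composite legs.
record IsComposite {P Q R : FinPoset}
                   (s₁ : Span P Q) (s₂ : Span Q R) (s : Span P R) : Set where
  field
    π₁       : Carrier (apex s) → Carrier (apex s₁)
    π₂       : Carrier (apex s) → Carrier (apex s₂)
    commutes : ∀ z → right s₁ (π₁ z) ≡ left s₂ (π₂ z)
    univ     : ∀ a b → right s₁ a ≡ left s₂ b →
               Σ (Carrier (apex s)) λ z →
                 (π₁ z ≡ a × π₂ z ≡ b) ×
                 (∀ z′ → π₁ z′ ≡ a × π₂ z′ ≡ b → z′ ≡ z)
    order    : ∀ z z′ → (_≤_ (apex s) z z′ →
                          _≤_ (apex s₁) (π₁ z) (π₁ z′) × _≤_ (apex s₂) (π₂ z) (π₂ z′))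
                      × (_≤_ (apex s₁) (π₁ z) (π₁ z′) × _≤_ (apex s₂) (π₂ z) (π₂ z′) →
                          _≤_ (apex s) z z′)
    left-eq  : ∀ z → left s z ≡ left s₁ (π₁ z)
    right-eq : ∀ z → right s z ≡ right s₂ (π₂ z)

-- Connected directed hereditary species: functors 𝕂_p → Set.
-- Morphisms of 𝕂_p are spans up to isomorphism; a functor is given on
-- span representatives, preserving identities and sending every
-- (representative of a) composite to the composite of the images.
-- (Invariance under span isomorphism follows from the two laws.)

record DHSpecies : Set₁ where
  field
    H        : FinPoset → Set
    act      : ∀ {P Q} → Span P Q → H P → H Q
    act-id   : ∀ {P} (x : H P) → act (idSpan P) x ≡ x
    act-comp : ∀ {P Q R} (s₁ : Span P Q) (s₂ : Span Q R) (s : Span P R) →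
               IsComposite s₁ s₂ s → ∀ x → act s x ≡ act s₂ (act s₁ x)

open DHSpecies public

-- The category ℍ (objects and morphisms; composition is that of 𝕂)

module _ (Hs : DHSpecies) where

  ObjH : Set₁
  ObjH = Σ FinPoset (H Hs)

  HomH : ObjH → ObjH → Set
  HomH (P , x) (Q , y) = Σ (Contraction P Q) λ f → act Hs (ι f) x ≡ y

  _≈H_ : ∀ {a b} → HomH a b → HomH a b → Set
  (f , _) ≈H (g , _) = ∀ p → fun f p ≡ fun g p

module _ {o h e : Level} {Obj : Set o} (Hom : Obj → Obj → Set h) where

  SameComponent : Obj → Obj → Set (o ⊔ h)
  SameComponent = Star (λ a b → Hom a b ⊎ Hom b a)

  record ChosenLocalTerminals
           (_≈_ : ∀ {a b} → Hom a b → Hom a b → Set e)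
           {i : Level} (I : Set i) (chosen : I → Obj) : Set (o ⊔ h ⊔ e ⊔ i) where
    field
      covers   : ∀ a → Σ I λ j → SameComponent a (chosen j)
      distinct : ∀ j k → SameComponent (chosen j) (chosen k) → j ≡ k
      terminal : ∀ j a → SameComponent a (chosen j) →
                 Σ (Hom a (chosen j)) λ t → ∀ t′ → t ≈ t′

𝟙 : FinPoset
𝟙 = record
  { Carrier = ⊤
  ; _≤_ = λ _ _ → ⊤
  ; isPartialOrder = record
      { isPreorder = record
          { isEquivalence = isEquivalence
          ; reflexive = λ _ → tt
          ; trans = λ _ _ → tt }
      ; antisym = λ _ _ → refl }
  ; size = 1
  ; enum = mk↔ₛ′ (λ _ → tt) (λ _ → zero) (λ _ → refl) (λ { zero → refl ; (Fin.suc ()) })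
  ; point = tt
  ; connected = λ _ _ → ε }

{-# OPTIONS --safe #-}
-- Every finite connected poset has a unique map to 𝟙, and it is a
-- contraction, so (P , x) ↦ H(P → 𝟙)(x) ∈ H[𝟙] is the only candidate label
-- of the component of (P , x). Functoriality of H along the triangle
-- P → Q → 𝟙 makes this label invariant under morphisms of ℍ, hence constant
-- on components, and on (𝟙 , j) it is j. So each component contains exactly
-- one chosen object, and the collapse P → 𝟙 is its unique map into it.
module Submission where

open import Defs
open import Data.Product using (_,_; proj₁; proj₂)
open import Data.Unit using (tt)
open import Data.Sum using (_⊎_; inj₁; [_,_])
open import Data.Empty using (⊥-elim)
open import Function using (id; _∘_)
open import Relation.Binary.PropositionalEquality
  using (_≡_; _≗_; refl; sym; trans; cong)
open import Relation.Binary.Construct.Closure.ReflexiveTransitive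
  using (Star; ε; _◅_; fold; map)

idContraction : (P : FinPoset) → Contraction P P
idContraction P = record { fun = id ; isContraction = id-contraction P }

collapse : (P : FinPoset) → Contraction P 𝟙
collapse P = record
  { fun           = λ _ → tt
  ; isContraction = record
    { mono            = λ _ → tt
    ; surjective      = λ _ → point P , refl
    ; fibre-connected = λ _ x y _ _ → map ((refl , refl) ,_) (connected P x y)
    ; fibre-convex    = λ _ _ _ _ _ _ _ _ → refl
    ; covers-lift     = λ _ _ tt⋖tt → ⊥-elim (proj₂ (proj₁ tt⋖tt) refl)
    }
  }

-- The pullback of ι f and ι g is P itself, with projections id and fun f.
ι-composite : ∀ {P Q R} (f : Contraction P Q) (g : Contraction Q R)
              (h : Contraction P R) → fun h ≗ fun g ∘ fun f →
              IsComposite (ι f) (ι g) (ι h)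
ι-composite f g h h≗g∘f = record
  { π₁       = id
  ; π₂       = fun f
  ; commutes = λ _ → refl
  ; univ     = λ a _ fa≡b → a , (refl , fa≡b) , λ _ → proj₁
  ; order    = λ _ _ → (λ z≤z′ → z≤z′ , IsContraction.mono (isContraction f) z≤z′)
                     , proj₁
  ; left-eq  = λ _ → refl
  ; right-eq = h≗g∘f
  }

module _ (Hs : DHSpecies) where

  act-ι-∘ : ∀ {P Q R} (f : Contraction P Q) (g : Contraction Q R)
            (h : Contraction P R) → fun h ≗ fun g ∘ fun f →
            ∀ x → act Hs (ι h) x ≡ act Hs (ι g) (act Hs (ι f) x)
  act-ι-∘ f g h h≗g∘f = act-comp Hs (ι f) (ι g) (ι h) (ι-composite f g h h≗g∘f)

  act-ι-cong : ∀ {P Q} (f g : Contraction P Q) → fun f ≗ fun g →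
               ∀ x → act Hs (ι f) x ≡ act Hs (ι g) x
  act-ι-cong {P} f g f≗g x =
    trans (act-ι-∘ (idContraction P) g f f≗g x) (cong (act Hs (ι g)) (act-id Hs x))

  label : ObjH Hs → H Hs 𝟙
  label (P , x) = act Hs (ι (collapse P)) x

  label-𝟙 : ∀ j → label (𝟙 , j) ≡ j
  label-𝟙 j = trans (act-ι-cong (collapse 𝟙) (idContraction 𝟙) (λ _ → refl) j)
                    (act-id Hs j)

  label-hom : ∀ {a b} → HomH Hs a b → label a ≡ label b
  label-hom {P , x} {Q , _} (f , fx≡y) =
    trans (act-ι-∘ f (collapse Q) (collapse P) (λ _ → refl) x)
          (cong (act Hs (ι (collapse Q))) fx≡y)

  label-component : ∀ {a b} → Star (λ a b → HomH Hs a b ⊎ HomH Hs b a) a b →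
                    label a ≡ label b
  label-component = fold (λ a b → label a ≡ label b)
    (λ step → trans ([ label-hom , sym ∘ label-hom ] step)) refl

lemma8p3 : (Hs : DHSpecies) →
    ChosenLocalTerminals (HomH Hs) (_≈H_ Hs) (H Hs 𝟙) (λ x → 𝟙 , x)
lemma8p3 Hs = record
  { covers   = λ { (P , x) → label Hs (P , x) , inj₁ (collapse P , refl) ◅ ε }
  ; distinct = λ j k j~k →
      trans (sym (label-𝟙 Hs j)) (trans (label-component Hs j~k) (label-𝟙 Hs k))
  ; terminal = λ { j (P , x) a~j →
      (collapse P , trans (label-component Hs a~j) (label-𝟙 Hs j)) , λ _ _ → refl }
  }
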